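{- For every $n\ge1$ and every integer $r$ with $1\le r\le 2^n-1$ there is a weighted game on $n$ voters of rank $r$. Moreover, each of the sets $\mathcal{W}_n^+$, $\Pi_n$ and $J_n^+$ contains an element of rank $r$ for every integer $r$ with $2^{n-1}\le r\le 2^n-1$.
   Context: Let $N=\{1,\dots,n\}$. A simple game is a family $W$ of subsets of $N$ (winning coalitions) with $N\in W$, $\emptyset\notin W$, closed under supersets. Order subsets of $N$ by: for $A=\{a_1>\dots>a_k\}$, $B=\{b_1>\dots>b_j\}$, $B\ge A$ iff $k\le j$ and $b_i\ge a_i$ for $i\le k$. A linear game is a simple game whose winning set is an up-set for this order; $J_n$ is the set of linear games on $n$ voters, and the rank of a game is its number of losing coalitions. $J_n^+$ is the set of linear games of rank at least $2^{n-1}$. A game is proper if no coalition and its complement are both winning; $\Pi_n$ is the set of proper linear games. A linear game is weighted if there exist $w_n\ge\dots\ge w_1\ge0$ and $q\in(0,\sum_i w_i]$ with $A$ winning iff $\sum_{i\in A}w_i\ge q$; $\mathcal{W}_n^+$ is the set of weighted games of rank at least $2^{n-1}$. -}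

module Defs where

open import Data.Bool using (Bool; true; false; if_then_else_)
open import Data.Nat using (ℕ; zero; suc; _≤_)
open import Data.Fin using (Fin; toℕ)
import Data.Fin as Fin
open import Data.Fin.Subset using (Subset; ⊥; ⊤; _⊆_; ∁)
open import Data.Vec using (Vec; []; _∷_)
open import Data.List using (List; []; _∷_; _++_; map; reverse; length; filter)
open import Data.Product using (Σ; _×_; ∃)
open import Data.Unit using () renaming (⊤ to Unit)
open import Data.Empty using () renaming (⊥ to Empty)
open import Data.Rational using (ℚ; 0ℚ; _+_; _<_) renaming (_≤_ to _≤ℚ_)
open import Relation.Binary.PropositionalEquality using (_≡_)
open import Function.Bundles using (_⇔_)
open import Relation.Nullary.Decidable using (¬?)
open import Data.Bool using (T)
open import Data.Bool.Properties using (T?)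

-- Voters are Fin n; index i stands for voter (toℕ i + 1).
-- A game is given by its (decidable) set of winning coalitions.
Game : ℕ → Set
Game n = Subset n → Bool

Winning : ∀ {n} → Game n → Subset n → Set
Winning W A = W A ≡ true

IsSimple : ∀ {n} → Game n → Set
IsSimple {n} W =
  Winning W ⊤ × W ⊥ ≡ false ×
  (∀ (A B : Subset n) → A ⊆ B → Winning W A → Winning W B)

elemsAsc : ∀ {n} → Subset n → List ℕ
elemsAsc [] = []
elemsAsc (b ∷ A) = (if b then 0 ∷ [] else []) ++ map suc (elemsAsc A)

elemsDesc : ∀ {n} → Subset n → List ℕ
elemsDesc A = reverse (elemsAsc A)

Dominates : List ℕ → List ℕ → Set
Dominates [] bs = Unit
Dominates (a ∷ as) [] = Empty
Dominates (a ∷ as) (b ∷ bs) = a ≤ b × Dominates as bs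

_≽_ : ∀ {n} → Subset n → Subset n → Set
B ≽ A = Dominates (elemsDesc A) (elemsDesc B)

IsLinear : ∀ {n} → Game n → Set
IsLinear {n} W = IsSimple W × (∀ (A B : Subset n) → B ≽ A → Winning W A → Winning W B)

allSubsets : ∀ n → List (Subset n)
allSubsets zero = [] ∷ []
allSubsets (suc n) = map (true ∷_) (allSubsets n) ++ map (false ∷_) (allSubsets n)

rank : ∀ {n} → Game n → ℕ
rank {n} W = length (filter (λ A → ¬? (T? (W A))) (allSubsets n))

weightOf : ∀ {n} → (Fin n → ℚ) → Subset n → ℚ
weightOf w [] = 0ℚ
weightOf w (b ∷ A) = (if b then w Fin.zero else 0ℚ) + weightOf (λ i → w (Fin.suc i)) A

IsWeightedBy : ∀ {n} → Game n → (Fin n → ℚ) → ℚ → Set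
IsWeightedBy {n} W w q =
  (∀ i → 0ℚ ≤ℚ w i) ×
  (∀ (i j : Fin n) → i Fin.≤ j → w i ≤ℚ w j) ×
  0ℚ < q × q ≤ℚ weightOf w ⊤ ×
  (∀ (A : Subset n) → Winning W A ⇔ (q ≤ℚ weightOf w A))

IsWeighted : ∀ {n} → Game n → Set
IsWeighted {n} W = Σ (Fin n → ℚ) λ w → Σ ℚ λ q → IsWeightedBy W w q

IsProper : ∀ {n} → Game n → Set
IsProper {n} W = ∀ (A : Subset n) → Winning W A → W (∁ A) ≡ false

-- Weigh voter i + 1 by 2^i, so that the weight of a coalition is its binary value, and take
-- quota q.  The weights are nondecreasing, so this weighted game is linear.  Its losing
-- coalitions are those of value < q; splitting on the lowest bit, they number ⌊q/2⌋ + ⌈q/2⌉ = q,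
-- so the game has rank q.  As value(A) + value(∁ A) = 2^n − 1, it is proper once q ≥ 2^(n−1).
module Submission where

open import Defs
open import Data.Bool using (true; false; T)
open import Data.Bool.Properties using (T?; T-≡; ¬-not)
open import Data.Fin using (Fin; toℕ)
import Data.Fin as Fin
open import Data.Fin.Subset using (Subset; ⊥; ⊤; _⊆_; ∁)
open import Data.Fin.Subset.Properties using (drop-∷-⊆)
open import Data.Vec using ([]; _∷_; here)
open import Data.List using ([]; _∷_; _++_; map; length; filter; reverse)
open import Data.List.Properties using (filter-++; filter-≐; length-++; reverse-map)
open import Data.List.Relation.Binary.Permutation.Propositional.Properties using (↭-reverse)
open import Data.Nat
  using (ℕ; zero; suc; _+_; _*_; _^_; _∸_; _≤_; _<_; z≤n; s≤s; s≤s⁻¹; _≤ᵇ_; _≤?_; _<?_; ⌊_/2⌋; ⌈_/2⌉)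
open import Data.Nat.Properties
open import Data.Nat.ListAction using (sum)
open import Data.Nat.ListAction.Properties using (sum-↭)
open import Data.Nat.Tactic.RingSolver using (solve-∀)
open import Data.Product using (Σ; _×_; _,_)
open import Data.Rational using (ℚ; 0ℚ; 1ℚ) renaming (_≤_ to _≤ℚ_; _<_ to _<ℚ_; _+_ to _+ℚ_)
import Data.Rational.Properties as ℚP
open import Function using (_∘_)
open import Function.Bundles using (_⇔_; mk⇔; Equivalence)
open import Relation.Nullary using (¬_; does; yes; no; contradiction)
open import Relation.Nullary.Decidable using (¬?)
open import Relation.Unary using (Pred; Decidable)
open import Relation.Binary.PropositionalEquality
  using (_≡_; refl; sym; trans; cong; cong₂; subst; subst₂; module ≡-Reasoning)

open Equivalence using (to; from)

2*m≡m+m : ∀ m → 2 * m ≡ m + m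
2*m≡m+m m = cong (m +_) (+-identityʳ m)

2*m≤n⇔m≤⌊n/2⌋ : ∀ m n → 2 * m ≤ n ⇔ m ≤ ⌊ n /2⌋
2*m≤n⇔m≤⌊n/2⌋ m n = mk⇔ halve double
  where
  halve : 2 * m ≤ n → m ≤ ⌊ n /2⌋
  halve 2m≤n = ≤-trans (≤-reflexive (n≡⌊n+n/2⌋ m)) (⌊n/2⌋-mono (subst (_≤ n) (2*m≡m+m m) 2m≤n))
  double : m ≤ ⌊ n /2⌋ → 2 * m ≤ n
  double m≤ = begin
    2 * m               ≤⟨ *-monoʳ-≤ 2 m≤ ⟩
    2 * ⌊ n /2⌋         ≡⟨ 2*m≡m+m ⌊ n /2⌋ ⟩
    ⌊ n /2⌋ + ⌊ n /2⌋   ≤⟨ +-monoʳ-≤ ⌊ n /2⌋ (⌊n/2⌋≤⌈n/2⌉ n) ⟩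
    ⌊ n /2⌋ + ⌈ n /2⌉   ≡⟨ ⌊n/2⌋+⌈n/2⌉≡n n ⟩
    n                   ∎
    where open ≤-Reasoning

1+2*m<n⇔m<⌊n/2⌋ : ∀ m n → suc (2 * m) < n ⇔ m < ⌊ n /2⌋
1+2*m<n⇔m<⌊n/2⌋ m n = mk⇔
  (to (2*m≤n⇔m≤⌊n/2⌋ (suc m) n) ∘ subst (_≤ n) (sym (*-suc 2 m)))
  (subst (_≤ n) (*-suc 2 m) ∘ from (2*m≤n⇔m≤⌊n/2⌋ (suc m) n))

2*m<n⇔m<⌈n/2⌉ : ∀ m n → 2 * m < n ⇔ m < ⌈ n /2⌉
2*m<n⇔m<⌈n/2⌉ m n = mk⇔
  (to (1+2*m<n⇔m<⌊n/2⌋ m (suc n)) ∘ s≤s)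
  (s≤s⁻¹ ∘ from (1+2*m<n⇔m<⌊n/2⌋ m (suc n)))

binaryValue : ∀ {n} → Subset n → ℕ
binaryValue []          = 0
binaryValue (true ∷ A)  = 1 + 2 * binaryValue A
binaryValue (false ∷ A) = 2 * binaryValue A

binaryValue-⊥ : ∀ n → binaryValue (⊥ {n}) ≡ 0
binaryValue-⊥ zero    = refl
binaryValue-⊥ (suc n) = cong (2 *_) (binaryValue-⊥ n)

1+binaryValue-⊤ : ∀ n → 1 + binaryValue (⊤ {n}) ≡ 2 ^ n
1+binaryValue-⊤ zero    = refl
1+binaryValue-⊤ (suc n) = trans (sym (*-suc 2 (binaryValue (⊤ {n})))) (cong (2 *_) (1+binaryValue-⊤ n))

binaryValue-⊤ : ∀ n → binaryValue (⊤ {n}) ≡ 2 ^ n ∸ 1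
binaryValue-⊤ n = cong (_∸ 1) (1+binaryValue-⊤ n)

2*a+2*b≡2*c : ∀ a b {c} → a + b ≡ c → 2 * a + 2 * b ≡ 2 * c
2*a+2*b≡2*c a b refl = sym (*-distribˡ-+ 2 a b)

binaryValue-∁ : ∀ {n} (A : Subset n) → binaryValue A + binaryValue (∁ A) ≡ binaryValue (⊤ {n})
binaryValue-∁ []          = refl
binaryValue-∁ (true ∷ A)  = cong suc (2*a+2*b≡2*c (binaryValue A) (binaryValue (∁ A)) (binaryValue-∁ A))
binaryValue-∁ (false ∷ A) = trans (+-suc (2 * binaryValue A) (2 * binaryValue (∁ A)))
  (cong suc (2*a+2*b≡2*c (binaryValue A) (binaryValue (∁ A)) (binaryValue-∁ A)))

binaryValue-mono-⊆ : ∀ {n} (A B : Subset n) → A ⊆ B → binaryValue A ≤ binaryValue B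
binaryValue-mono-⊆ []          []          _   = z≤n
binaryValue-mono-⊆ (true ∷ A)  (true ∷ B)  A⊆B = s≤s (*-monoʳ-≤ 2 (binaryValue-mono-⊆ A B (drop-∷-⊆ A⊆B)))
binaryValue-mono-⊆ (true ∷ A)  (false ∷ B) A⊆B with A⊆B here
... | ()
binaryValue-mono-⊆ (false ∷ A) (true ∷ B)  A⊆B = m≤n⇒m≤1+n (*-monoʳ-≤ 2 (binaryValue-mono-⊆ A B (drop-∷-⊆ A⊆B)))
binaryValue-mono-⊆ (false ∷ A) (false ∷ B) A⊆B = *-monoʳ-≤ 2 (binaryValue-mono-⊆ A B (drop-∷-⊆ A⊆B))

sum-map-2^-suc : ∀ xs → sum (map (2 ^_) (map suc xs)) ≡ 2 * sum (map (2 ^_) xs)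
sum-map-2^-suc []       = refl
sum-map-2^-suc (x ∷ xs) =
  trans (cong (2 * 2 ^ x +_) (sum-map-2^-suc xs)) (sym (*-distribˡ-+ 2 (2 ^ x) (sum (map (2 ^_) xs))))

binaryValue≡sum-elemsAsc : ∀ {n} (A : Subset n) → binaryValue A ≡ sum (map (2 ^_) (elemsAsc A))
binaryValue≡sum-elemsAsc []          = refl
binaryValue≡sum-elemsAsc (true ∷ A)  =
  cong suc (trans (cong (2 *_) (binaryValue≡sum-elemsAsc A)) (sym (sum-map-2^-suc (elemsAsc A))))
binaryValue≡sum-elemsAsc (false ∷ A) =
  trans (cong (2 *_) (binaryValue≡sum-elemsAsc A)) (sym (sum-map-2^-suc (elemsAsc A)))

binaryValue≡sum-elemsDesc : ∀ {n} (A : Subset n) → binaryValue A ≡ sum (map (2 ^_) (elemsDesc A))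
binaryValue≡sum-elemsDesc A = begin
  binaryValue A                        ≡⟨ binaryValue≡sum-elemsAsc A ⟩
  sum (map (2 ^_) (elemsAsc A))        ≡⟨ sum-↭ (↭-reverse (map (2 ^_) (elemsAsc A))) ⟨
  sum (reverse (map (2 ^_) (elemsAsc A))) ≡⟨ cong sum (reverse-map (2 ^_) (elemsAsc A)) ⟨
  sum (map (2 ^_) (elemsDesc A))       ∎
  where open ≡-Reasoning

sum-map-mono-Dominates : ∀ {f : ℕ → ℕ} → (∀ {a b} → a ≤ b → f a ≤ f b) →
  ∀ as bs → Dominates as bs → sum (map f as) ≤ sum (map f bs)
sum-map-mono-Dominates f-mono []       bs       _           = z≤n
sum-map-mono-Dominates f-mono (a ∷ as) (b ∷ bs) (a≤b , dom) =
  +-mono-≤ (f-mono a≤b) (sum-map-mono-Dominates f-mono as bs dom)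

binaryValue-mono-≽ : ∀ {n} (A B : Subset n) → B ≽ A → binaryValue A ≤ binaryValue B
binaryValue-mono-≽ A B B≽A = subst₂ _≤_ (sym (binaryValue≡sum-elemsDesc A)) (sym (binaryValue≡sum-elemsDesc B))
  (sum-map-mono-Dominates (^-monoʳ-≤ 2) (elemsDesc A) (elemsDesc B) B≽A)

threshold : ∀ {n} → (Subset n → ℕ) → ℕ → Game n
threshold v q A = q ≤ᵇ v A

module _ {n} (v : Subset n → ℕ) (q : ℕ) where

  threshold-wins : ∀ A → Winning (threshold v q) A ⇔ q ≤ v A
  threshold-wins A = mk⇔ (≤ᵇ⇒≤ q (v A) ∘ from T-≡) (to T-≡ ∘ ≤⇒≤ᵇ)

  threshold-loses : ∀ A → (¬ T (threshold v q A)) ⇔ v A < q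
  threshold-loses A = mk⇔ (λ lose → ≰⇒> (lose ∘ ≤⇒≤ᵇ)) (λ v<q win → <⇒≱ v<q (≤ᵇ⇒≤ q (v A) win))

  threshold-isLinear : (∀ A B → A ⊆ B → v A ≤ v B) → (∀ A B → B ≽ A → v A ≤ v B) →
    v ⊥ ≡ 0 → 1 ≤ q → q ≤ v ⊤ → IsLinear (threshold v q)
  threshold-isLinear v-mono-⊆ v-mono-≽ v⊥≡0 1≤q q≤v⊤ =
    (from (threshold-wins ⊤) q≤v⊤ , ⊥-loses , λ A B A⊆B → upward (v-mono-⊆ A B A⊆B)) ,
    λ A B B≽A → upward (v-mono-≽ A B B≽A)
    where
    upward : ∀ {A B} → v A ≤ v B → Winning (threshold v q) A → Winning (threshold v q) B
    upward {A} {B} vA≤vB = from (threshold-wins B) ∘ (λ q≤vA → ≤-trans q≤vA vA≤vB) ∘ to (threshold-wins A)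
    ⊥-loses : threshold v q ⊥ ≡ false
    ⊥-loses = ¬-not (λ win → <⇒≱ 1≤q (subst (q ≤_) v⊥≡0 (to (threshold-wins ⊥) win)))

  threshold-isProper : (∀ A → v A + v (∁ A) < q + q) → IsProper (threshold v q)
  threshold-isProper v+v∁<2q A win = ¬-not λ win∁ →
    <⇒≱ (v+v∁<2q A) (+-mono-≤ (to (threshold-wins A) win) (to (threshold-wins (∁ A)) win∁))

  rank-threshold : rank (threshold v q) ≡ length (filter (λ A → v A <? q) (allSubsets n))
  rank-threshold = cong length (filter-≐ (λ A → ¬? (T? (threshold v q A))) (λ A → v A <? q)
    ((λ {A} → to (threshold-loses A)) , (λ {A} → from (threshold-loses A))) (allSubsets n))

length-filter-map : ∀ {a b p} {A : Set a} {B : Set b} {P : Pred B p} (P? : Decidable P) (f : A → B) xs →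
  length (filter P? (map f xs)) ≡ length (filter (P? ∘ f) xs)
length-filter-map P? f []       = refl
length-filter-map P? f (x ∷ xs) with does (P? (f x))
... | true  = cong suc (length-filter-map P? f xs)
... | false = length-filter-map P? f xs

count-binaryValue< : ∀ n q → q ≤ 2 ^ n → length (filter (λ A → binaryValue A <? q) (allSubsets n)) ≡ q
count-binaryValue< zero    zero          _         = refl
count-binaryValue< zero    (suc zero)    _         = refl
count-binaryValue< zero    (suc (suc q)) (s≤s ())
count-binaryValue< (suc n) q             q≤2^1+n   = begin
  length (filter below (map (true ∷_) S ++ map (false ∷_) S))
    ≡⟨ cong length (filter-++ below (map (true ∷_) S) (map (false ∷_) S)) ⟩
  length (filter below (map (true ∷_) S) ++ filter below (map (false ∷_) S))
    ≡⟨ length-++ (filter below (map (true ∷_) S)) ⟩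
  length (filter below (map (true ∷_) S)) + length (filter below (map (false ∷_) S))
    ≡⟨ cong₂ _+_ (count-half true  ⌊ q /2⌋ (λ A → 1+2*m<n⇔m<⌊n/2⌋ (binaryValue A) q)
                   (≤-trans (⌊n/2⌋≤⌈n/2⌉ q) ⌈q/2⌉≤2^n))
                 (count-half false ⌈ q /2⌉ (λ A → 2*m<n⇔m<⌈n/2⌉ (binaryValue A) q) ⌈q/2⌉≤2^n) ⟩
  ⌊ q /2⌋ + ⌈ q /2⌉
    ≡⟨ ⌊n/2⌋+⌈n/2⌉≡n q ⟩
  q ∎
  where
  open ≡-Reasoning
  S = allSubsets n
  below : Decidable (λ (A : Subset (suc n)) → binaryValue A < q)
  below A = binaryValue A <? q

  ⌈q/2⌉≤2^n : ⌈ q /2⌉ ≤ 2 ^ n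
  ⌈q/2⌉≤2^n = ≤-trans (⌈n/2⌉-mono (subst (q ≤_) (2*m≡m+m (2 ^ n)) q≤2^1+n))
                      (≤-reflexive (sym (n≡⌈n+n/2⌉ (2 ^ n))))

  count-half : ∀ b h → (∀ A → binaryValue (b ∷ A) < q ⇔ binaryValue A < h) → h ≤ 2 ^ n →
    length (filter below (map (b ∷_) S)) ≡ h
  count-half b h below⇔ h≤2^n = begin
    length (filter below (map (b ∷_) S))          ≡⟨ length-filter-map below (b ∷_) S ⟩
    length (filter (below ∘ (b ∷_)) S)            ≡⟨ cong length (filter-≐ (below ∘ (b ∷_)) (λ A → binaryValue A <? h)
                                                       ((λ {A} → to (below⇔ A)) , (λ {A} → from (below⇔ A))) S) ⟩
    length (filter (λ A → binaryValue A <? h) S)  ≡⟨ count-binaryValue< n h h≤2^n ⟩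
    h                                             ∎

fromℕ : ℕ → ℚ
fromℕ zero    = 0ℚ
fromℕ (suc n) = 1ℚ +ℚ fromℕ n

fromℕ-+ : ∀ a b → fromℕ (a + b) ≡ fromℕ a +ℚ fromℕ b
fromℕ-+ zero    b = sym (ℚP.+-identityˡ (fromℕ b))
fromℕ-+ (suc a) b = trans (cong (1ℚ +ℚ_) (fromℕ-+ a b)) (sym (ℚP.+-assoc 1ℚ (fromℕ a) (fromℕ b)))

fromℕ-nonNeg : ∀ a → 0ℚ ≤ℚ fromℕ a
fromℕ-nonNeg zero    = ℚP.≤-refl
fromℕ-nonNeg (suc a) = ℚP.+-mono-≤ (ℚP.<⇒≤ (ℚP.positive⁻¹ 1ℚ)) (fromℕ-nonNeg a)

fromℕ-pos : ∀ a → 0ℚ <ℚ fromℕ (suc a)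
fromℕ-pos a = ℚP.+-mono-<-≤ (ℚP.positive⁻¹ 1ℚ) (fromℕ-nonNeg a)

fromℕ-mono-≤ : ∀ {a b} → a ≤ b → fromℕ a ≤ℚ fromℕ b
fromℕ-mono-≤ {a} a≤b with m≤n⇒∃[o]m+o≡n a≤b
... | k , refl = subst₂ _≤ℚ_ (ℚP.+-identityʳ (fromℕ a)) (sym (fromℕ-+ a k)) (ℚP.+-monoʳ-≤ (fromℕ a) (fromℕ-nonNeg k))

fromℕ-mono-< : ∀ {a b} → a < b → fromℕ a <ℚ fromℕ b
fromℕ-mono-< {a} a<b = ℚP.<-≤-trans a<1+a (fromℕ-mono-≤ a<b)
  where
  a<1+a : fromℕ a <ℚ fromℕ (suc a)
  a<1+a = subst (_<ℚ fromℕ (suc a)) (ℚP.+-identityˡ (fromℕ a)) (ℚP.+-monoˡ-< (fromℕ a) (ℚP.positive⁻¹ 1ℚ))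

fromℕ-cancel-≤ : ∀ {a b} → fromℕ a ≤ℚ fromℕ b → a ≤ b
fromℕ-cancel-≤ {a} {b} ⟦a⟧≤⟦b⟧ with a ≤? b
... | yes a≤b = a≤b
... | no  a≰b = contradiction (ℚP.<-≤-trans (fromℕ-mono-< (≰⇒> a≰b)) ⟦a⟧≤⟦b⟧) (ℚP.<-irrefl refl)

weightOf-cong : ∀ {n} {w w′ : Fin n → ℚ} → (∀ i → w i ≡ w′ i) → ∀ A → weightOf w A ≡ weightOf w′ A
weightOf-cong w≗w′ []          = refl
weightOf-cong w≗w′ (true ∷ A)  = cong₂ _+ℚ_ (w≗w′ Fin.zero) (weightOf-cong (w≗w′ ∘ Fin.suc) A)
weightOf-cong w≗w′ (false ∷ A) = cong (0ℚ +ℚ_) (weightOf-cong (w≗w′ ∘ Fin.suc) A)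

powersOfTwo : ∀ {n} → Fin n → ℚ
powersOfTwo i = fromℕ (2 ^ toℕ i)

-- The factor m absorbs the doubling of the weights when passing to the tail of a coalition.
weightOf-scaledPowersOfTwo : ∀ {n} m (A : Subset n) →
  weightOf (λ i → fromℕ (m * 2 ^ toℕ i)) A ≡ fromℕ (m * binaryValue A)
weightOf-scaledPowersOfTwo m []          = cong fromℕ (sym (*-zeroʳ m))
weightOf-scaledPowersOfTwo m (true ∷ A)  = begin
  fromℕ (m * 1) +ℚ weightOf (λ i → fromℕ (m * (2 * 2 ^ toℕ i))) A ≡⟨ cong (fromℕ (m * 1) +ℚ_) tail ⟩
  fromℕ (m * 1) +ℚ fromℕ (m * 2 * binaryValue A)                  ≡⟨ fromℕ-+ (m * 1) (m * 2 * binaryValue A) ⟨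
  fromℕ (m * 1 + m * 2 * binaryValue A)                           ≡⟨ cong fromℕ (distrib m (binaryValue A)) ⟩
  fromℕ (m * (1 + 2 * binaryValue A))                             ∎
  where
  open ≡-Reasoning
  distrib : ∀ m v → m * 1 + m * 2 * v ≡ m * (1 + 2 * v)
  distrib = solve-∀
  tail : weightOf (λ i → fromℕ (m * (2 * 2 ^ toℕ i))) A ≡ fromℕ (m * 2 * binaryValue A)
  tail = trans (weightOf-cong (λ i → cong fromℕ (sym (*-assoc m 2 (2 ^ toℕ i)))) A)
               (weightOf-scaledPowersOfTwo (m * 2) A)
weightOf-scaledPowersOfTwo m (false ∷ A) = begin
  0ℚ +ℚ weightOf (λ i → fromℕ (m * (2 * 2 ^ toℕ i))) A ≡⟨ ℚP.+-identityˡ _ ⟩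
  weightOf (λ i → fromℕ (m * (2 * 2 ^ toℕ i))) A       ≡⟨ weightOf-cong (λ i → cong fromℕ (sym (*-assoc m 2 (2 ^ toℕ i)))) A ⟩
  weightOf (λ i → fromℕ (m * 2 * 2 ^ toℕ i)) A         ≡⟨ weightOf-scaledPowersOfTwo (m * 2) A ⟩
  fromℕ (m * 2 * binaryValue A)                        ≡⟨ cong fromℕ (*-assoc m 2 (binaryValue A)) ⟩
  fromℕ (m * (2 * binaryValue A))                      ∎
  where open ≡-Reasoning

weightOf-powersOfTwo : ∀ {n} (A : Subset n) → weightOf powersOfTwo A ≡ fromℕ (binaryValue A)
weightOf-powersOfTwo A = begin
  weightOf powersOfTwo A                          ≡⟨ weightOf-cong (λ i → cong fromℕ (sym (*-identityˡ (2 ^ toℕ i)))) A ⟩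
  weightOf (λ i → fromℕ (1 * 2 ^ toℕ i)) A        ≡⟨ weightOf-scaledPowersOfTwo 1 A ⟩
  fromℕ (1 * binaryValue A)                       ≡⟨ cong fromℕ (*-identityˡ (binaryValue A)) ⟩
  fromℕ (binaryValue A)                           ∎
  where open ≡-Reasoning

threshold-isWeightedBy : ∀ {n} (v : Subset n → ℕ) (w : Fin n → ℚ) {q} →
  (∀ i → 0ℚ ≤ℚ w i) → (∀ i j → i Fin.≤ j → w i ≤ℚ w j) → (∀ A → weightOf w A ≡ fromℕ (v A)) →
  1 ≤ q → q ≤ v ⊤ → IsWeightedBy (threshold v q) w (fromℕ q)
threshold-isWeightedBy v w {suc q} w-nonNeg w-mono w≡v _ q≤v⊤ =
  w-nonNeg , w-mono , fromℕ-pos q , reaches-quota ⊤ q≤v⊤ ,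
  λ A → mk⇔ (reaches-quota A ∘ to (threshold-wins v (suc q) A))
            (from (threshold-wins v (suc q) A) ∘ reaches-quota⁻¹ A)
  where
  reaches-quota : ∀ A → suc q ≤ v A → fromℕ (suc q) ≤ℚ weightOf w A
  reaches-quota A q≤vA = subst (fromℕ (suc q) ≤ℚ_) (sym (w≡v A)) (fromℕ-mono-≤ q≤vA)
  reaches-quota⁻¹ : ∀ A → fromℕ (suc q) ≤ℚ weightOf w A → suc q ≤ v A
  reaches-quota⁻¹ A q≤wA = fromℕ-cancel-≤ (subst (fromℕ (suc q) ≤ℚ_) (w≡v A) q≤wA)

binaryGame : ∀ {n} → ℕ → Game n
binaryGame = threshold binaryValue

module _ (n : ℕ) {q : ℕ} (1≤q : 1 ≤ q) (q≤2^n∸1 : q ≤ 2 ^ n ∸ 1) where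

  private
    q≤value-⊤ : q ≤ binaryValue (⊤ {n})
    q≤value-⊤ = subst (q ≤_) (sym (binaryValue-⊤ n)) q≤2^n∸1

  binaryGame-isLinear : IsLinear (binaryGame {n} q)
  binaryGame-isLinear =
    threshold-isLinear binaryValue q binaryValue-mono-⊆ binaryValue-mono-≽ (binaryValue-⊥ n) 1≤q q≤value-⊤

  binaryGame-isWeighted : IsWeighted (binaryGame {n} q)
  binaryGame-isWeighted = powersOfTwo , fromℕ q ,
    threshold-isWeightedBy binaryValue powersOfTwo (fromℕ-nonNeg ∘ (2 ^_) ∘ toℕ)
      (λ i j i≤j → fromℕ-mono-≤ (^-monoʳ-≤ 2 i≤j)) weightOf-powersOfTwo 1≤q q≤value-⊤

  rank-binaryGame : rank (binaryGame {n} q) ≡ q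
  rank-binaryGame = trans (rank-threshold {n} binaryValue q)
    (count-binaryValue< n q (≤-trans q≤2^n∸1 (m∸n≤m (2 ^ n) 1)))

binaryGame-isProper : ∀ {n q} → 2 ^ (n ∸ 1) ≤ q → IsProper (binaryGame {n} q)
binaryGame-isProper {n} {q} 2^[n-1]≤q = threshold-isProper binaryValue q λ A → begin-strict
  binaryValue A + binaryValue (∁ A) ≡⟨ binaryValue-∁ A ⟩
  binaryValue (⊤ {n})              <⟨ n<1+n _ ⟩
  1 + binaryValue (⊤ {n})          ≡⟨ 1+binaryValue-⊤ n ⟩
  2 ^ n                            ≤⟨ 2^n≤2*2^[n-1] n ⟩
  2 * 2 ^ (n ∸ 1)                  ≡⟨ 2*m≡m+m (2 ^ (n ∸ 1)) ⟩
  2 ^ (n ∸ 1) + 2 ^ (n ∸ 1)        ≤⟨ +-mono-≤ 2^[n-1]≤q 2^[n-1]≤q ⟩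
  q + q                            ∎
  where
  open ≤-Reasoning
  2^n≤2*2^[n-1] : ∀ n → 2 ^ n ≤ 2 * 2 ^ (n ∸ 1)
  2^n≤2*2^[n-1] zero    = s≤s z≤n
  2^n≤2*2^[n-1] (suc n) = ≤-refl

proposition3p10 : (∀ (n : ℕ) → 1 ≤ n → ∀ (r : ℕ) → 1 ≤ r → r ≤ 2 ^ n ∸ 1 →
    Σ (Game n) λ W → IsLinear W × IsWeighted W × rank W ≡ r)
    ×
    (∀ (n : ℕ) → 1 ≤ n → ∀ (r : ℕ) → 2 ^ (n ∸ 1) ≤ r → r ≤ 2 ^ n ∸ 1 →
    (Σ (Game n) λ W → IsLinear W × IsWeighted W × rank W ≡ r)
    × (Σ (Game n) λ W → IsLinear W × IsProper W × rank W ≡ r)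
    × (Σ (Game n) λ W → IsLinear W × rank W ≡ r))
proposition3p10 = weightedOfEveryRank , λ n 1≤n r 2^[n-1]≤r r≤2^n∸1 →
  let 1≤r = ≤-trans (m^n>0 2 (n ∸ 1)) 2^[n-1]≤r
      (W , W-linear , W-weighted , rank-W) = weightedOfEveryRank n 1≤n r 1≤r r≤2^n∸1
  in (W , W-linear , W-weighted , rank-W) ,
     (W , W-linear , binaryGame-isProper 2^[n-1]≤r , rank-W) ,
     (W , W-linear , rank-W)
  where
  weightedOfEveryRank : ∀ (n : ℕ) → 1 ≤ n → ∀ (r : ℕ) → 1 ≤ r → r ≤ 2 ^ n ∸ 1 →
    Σ (Game n) λ W → IsLinear W × IsWeighted W × rank W ≡ r
  weightedOfEveryRank n _ r 1≤r r≤2^n∸1 =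
    binaryGame r , binaryGame-isLinear n 1≤r r≤2^n∸1 , binaryGame-isWeighted n 1≤r r≤2^n∸1 ,
    rank-binaryGame n 1≤r r≤2^n∸1
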